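{- For $|q|<1$, $$\frac{1}{(q;q)_\infty} \sum_{n=1}^\infty (-1)^{n-1} q^{3n(n+1)/2} = \frac{1}{(q,q^2;q^3)_\infty} \sum_{n=0}^\infty \frac{q^{3(n+1)^2}}{(q^3;q^3)_n(q^3;q^3)_{n+1}}.$$
   Context: Notation: $(a;q)_0=1$, $(a;q)_n=(1-a)(1-aq)\cdots(1-aq^{n-1})$ for $n>0$, $(a;q)_\infty=\lim_{n\to\infty}(a;q)_n$; $(a_1,\dots,a_r;q)_\infty=(a_1;q)_\infty\cdots(a_r;q)_\infty$. -}

module Defs where

-- Formal power series in q over ℤ, represented by their coefficient
-- sequences: a series f stands for Σ_{m ≥ 0} f m · q^m.

open import Data.Nat as ℕ using (ℕ; zero; suc; _∸_; _≤ᵇ_; _≡ᵇ_)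
open import Data.Integer using (ℤ; 0ℤ; 1ℤ; -1ℤ; _+_; _*_; -_)
open import Data.Bool using (if_then_else_)

Series : Set
Series = ℕ → ℤ

sumTo : ℕ → (ℕ → ℤ) → ℤ
sumTo zero    g = g 0
sumTo (suc n) g = sumTo n g + g (suc n)

oneS : Series
oneS zero    = 1ℤ
oneS (suc _) = 0ℤ

mono : ℕ → ℤ → Series
mono e c m = if m ≡ᵇ e then c else 0ℤ

infixl 7 _*S_
_*S_ : Series → Series → Series
(f *S g) n = sumTo n (λ k → f k * g (n ∸ k))

oneMinus : ℕ → Series
oneMinus e m = oneS m + (- mono e 1ℤ m)

-- Multiplicative inverse of a series with constant term 1:
-- b 0 = 1,  b n = - Σ_{j=1}^{n} f j · b (n - j).
-- invUpTo f N k is correct for k ≤ N.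
invUpTo : Series → ℕ → ℕ → ℤ
invUpTo f zero    k = 1ℤ
invUpTo f (suc N) k =
  if k ≤ᵇ N then invUpTo f N k
  else - sumTo N (λ i → f (suc i) * invUpTo f N (N ∸ i))

inv : Series → Series
inv f n = invUpTo f n n

poch : ℕ → ℕ → ℕ → Series
poch a s zero    = oneS
poch a s (suc n) = poch a s n *S oneMinus (a ℕ.+ s ℕ.* n)

-- infinite q-Pochhammer (q^a; q^s)_∞ for a ≥ 1, s ≥ 1: the k-th factor
-- is ≡ 1 mod q^{k+1}, so the coefficient of q^m of the infinite product
-- equals that of the finite product of the first m+1 factors.
pochInf : ℕ → ℕ → Series
pochInf a s m = poch a s (suc m) m

-- infinite sum Σ_{k ≥ 0} G k of series where G k has q-adic order ≥ k
-- (true of all sums used below): coefficient of q^m is Σ_{k ≤ m} (G k) m.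
sumInf : (ℕ → Series) → Series
sumInf G m = sumTo m (λ k → G k m)

tri : ℕ → ℕ
tri zero    = zero
tri (suc n) = suc n ℕ.+ tri n

sign : ℕ → ℤ
sign zero    = 1ℤ
sign (suc k) = - sign k

lhs4p1 : Series
lhs4p1 = inv (pochInf 1 1)
  *S sumInf (λ k → mono (3 ℕ.* tri (suc k)) (sign k))

rhs4p1 : Series
rhs4p1 = inv (pochInf 1 3 *S pochInf 2 3)
  *S sumInf (λ n → mono (3 ℕ.* (suc n ℕ.* suc n)) 1ℤ
                    *S inv (poch 3 3 n *S poch 3 3 (suc n)))

module Submission where

-- Since (q;q)_∞ = (q,q²;q³)_∞ (q³;q³)_∞, the theorem reduces to the core
-- identity, in the variable x = q³,
--   (x;x)_∞ Σ_{n≥0} x^{(n+1)²} / ((x;x)_n (x;x)_{n+1}) = Σ_{n≥0} (-1)^n x^{(n+1)(n+2)/2},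
-- which is proved for x = q^s with any s ≥ 1.  With
--   F j = Σ_n x^{n²+jn} / ((x;x)_n (x^{j+1};x)_n),   K j = Σ_n x^{n²+jn+n} / ((x;x)_n (x^{j+1};x)_n),
-- telescoping gives (1 - x^{j+1}) F j = F (j+1), whence (x^{j+1};x)_∞ F j = 1;
-- termwise algebra gives (1 - x^{j+1}) K j + x^{j+1} K (j+1) = F (j+1), so
-- H j = (x^{j+1};x)_∞ K j satisfies H j = 1 - x^{j+1} H (j+1), the same
-- recursion as the theta-type sum R j = Σ_n (-1)^n x^{jn + n(n+1)/2}; hence H = R.

open import Defs
open import Data.Nat as ℕ using (ℕ; zero; suc; _∸_; _≡ᵇ_; _≤ᵇ_; _<ᵇ_; z≤n; s≤s)
import Data.Nat.Properties as ℕP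
open import Data.Integer as ℤ using (ℤ; 0ℤ; 1ℤ; _+_; _*_; -_)
import Data.Integer.Properties as ℤP
open import Data.Bool using (true; false)
open import Data.Maybe using (Maybe; just; nothing)
open import Data.Product using (_,_)
open import Data.Sum using (inj₁; inj₂)
open import Function using (_∘_)
open import Relation.Binary.PropositionalEquality
open import Relation.Nullary using (yes; no; contradiction)
open import Algebra.Bundles using (CommutativeRing)
import Relation.Binary.Reasoning.Setoid
import Algebra.Solver.Ring.AlmostCommutativeRing as ACR
import Data.Nat.Tactic.RingSolver as ℕSolver
import Data.Integer.Tactic.RingSolver as ℤSolver

sumTo-cong≤ : ∀ n {g h : ℕ → ℤ} → (∀ k → k ℕ.≤ n → g k ≡ h k) → sumTo n g ≡ sumTo n h
sumTo-cong≤ zero    e = e 0 z≤n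
sumTo-cong≤ (suc n) e =
  cong₂ _+_ (sumTo-cong≤ n (λ k k≤n → e k (ℕP.m≤n⇒m≤1+n k≤n))) (e (suc n) ℕP.≤-refl)

sumTo-cong : ∀ n {g h : ℕ → ℤ} → (∀ k → g k ≡ h k) → sumTo n g ≡ sumTo n h
sumTo-cong n e = sumTo-cong≤ n (λ k _ → e k)

sumTo-front : ∀ n (g : ℕ → ℤ) → sumTo (suc n) g ≡ g 0 + sumTo n (g ∘ suc)
sumTo-front zero    g = refl
sumTo-front (suc n) g = trans (cong (_+ g (suc (suc n))) (sumTo-front n g))
  (ℤP.+-assoc (g 0) (sumTo n (g ∘ suc)) (g (suc (suc n))))

sumTo-+ : ∀ n (g h : ℕ → ℤ) → sumTo n (λ k → g k + h k) ≡ sumTo n g + sumTo n h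
sumTo-+ zero    g h = refl
sumTo-+ (suc n) g h =
  trans (cong (_+ (g (suc n) + h (suc n))) (sumTo-+ n g h))
        (interchange (sumTo n g) (sumTo n h) (g (suc n)) (h (suc n)))
  where
  interchange : ∀ a b c d → (a + b) + (c + d) ≡ (a + c) + (b + d)
  interchange = ℤSolver.solve-∀

sumTo-*ˡ : ∀ n c (g : ℕ → ℤ) → c * sumTo n g ≡ sumTo n (λ k → c * g k)
sumTo-*ˡ zero    c g = refl
sumTo-*ˡ (suc n) c g =
  trans (ℤP.*-distribˡ-+ c (sumTo n g) (g (suc n))) (cong (_+ c * g (suc n)) (sumTo-*ˡ n c g))

sumTo-neg : ∀ n (g : ℕ → ℤ) → - sumTo n g ≡ sumTo n (λ k → - g k)
sumTo-neg zero    g = refl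
sumTo-neg (suc n) g =
  trans (ℤP.neg-distrib-+ (sumTo n g) (g (suc n))) (cong (_+ - g (suc n)) (sumTo-neg n g))

sumTo-zero : ∀ n → sumTo n (λ _ → 0ℤ) ≡ 0ℤ
sumTo-zero zero    = refl
sumTo-zero (suc n) = trans (ℤP.+-identityʳ _) (sumTo-zero n)

sumTo-swap : ∀ n m (F : ℕ → ℕ → ℤ) →
             sumTo n (λ i → sumTo m (F i)) ≡ sumTo m (λ k → sumTo n (λ i → F i k))
sumTo-swap zero    m F = refl
sumTo-swap (suc n) m F = trans (cong (_+ sumTo m (F (suc n))) (sumTo-swap n m F))
  (sym (sumTo-+ m (λ k → sumTo n (λ i → F i k)) (F (suc n))))

sumTo-reverse : ∀ n (g : ℕ → ℤ) → sumTo n g ≡ sumTo n (λ k → g (n ∸ k))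
sumTo-reverse zero    g = refl
sumTo-reverse (suc n) g = begin
  sumTo (suc n) g                              ≡⟨ sumTo-front n g ⟩
  g 0 + sumTo n (g ∘ suc)                      ≡⟨ cong (g 0 +_) (sumTo-reverse n (g ∘ suc)) ⟩
  g 0 + sumTo n (λ k → g (suc (n ∸ k)))        ≡⟨ ℤP.+-comm (g 0) _ ⟩
  sumTo n (λ k → g (suc (n ∸ k))) + g 0
    ≡⟨ cong (_+ g 0) (sumTo-cong≤ n (λ k k≤n → cong g (sym (ℕP.+-∸-assoc 1 k≤n)))) ⟩
  sumTo n (λ k → g (suc n ∸ k)) + g 0
    ≡⟨ cong (λ i → sumTo n (λ k → g (suc n ∸ k)) + g i) (sym (ℕP.n∸n≡0 n)) ⟩
  sumTo (suc n) (λ k → g (suc n ∸ k))          ∎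
  where open ≡-Reasoning

sumTo-pad : ∀ j (g : ℕ → ℤ) → (∀ k → j ℕ.< k → g k ≡ 0ℤ) → ∀ d → sumTo j g ≡ sumTo (j ℕ.+ d) g
sumTo-pad j g z zero rewrite ℕP.+-identityʳ j = refl
sumTo-pad j g z (suc d) rewrite ℕP.+-suc j d =
  trans (sumTo-pad j g z d)
        (sym (trans (cong (sumTo (j ℕ.+ d) g +_) (z (suc (j ℕ.+ d)) (s≤s (ℕP.m≤m+n j d))))
                    (ℤP.+-identityʳ _)))

-- The ring of formal power series.  Series are compared pointwise (_≗_), the
-- ring operations being the coefficientwise sum and the Cauchy product _*S_.

infixl 6 _+S_
_+S_ : Series → Series → Series
(f +S g) n = f n + g n

-S_ : Series → Series
(-S f) n = - f n

0S : Series
0S _ = 0ℤ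

constS : ℤ → Series
constS c zero    = c
constS c (suc _) = 0ℤ

≗-sym : {f g : Series} → f ≗ g → g ≗ f
≗-sym e n = sym (e n)

+S-cong : {f f′ g g′ : Series} → f ≗ f′ → g ≗ g′ → f +S g ≗ f′ +S g′
+S-cong e e′ n = cong₂ _+_ (e n) (e′ n)

-S-cong : {f f′ : Series} → f ≗ f′ → -S f ≗ -S f′
-S-cong e n = cong -_ (e n)

*S-cong : {f f′ g g′ : Series} → f ≗ f′ → g ≗ g′ → f *S g ≗ f′ *S g′
*S-cong ef eg n = sumTo-cong n (λ k → cong₂ _*_ (ef k) (eg (n ∸ k)))

*S-congˡ : {f f′ : Series} (g : Series) → f ≗ f′ → f *S g ≗ f′ *S g
*S-congˡ {f} {f′} g e = *S-cong {f} {f′} {g} {g} e (λ _ → refl)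

*S-congʳ : (f : Series) {g g′ : Series} → g ≗ g′ → f *S g ≗ f *S g′
*S-congʳ f {g} {g′} e = *S-cong {f} {f} {g} {g′} (λ _ → refl) e

*S-cong≤ : ∀ f f′ g g′ m → (∀ k → k ℕ.≤ m → f k ≡ f′ k) → (∀ k → k ℕ.≤ m → g k ≡ g′ k) →
           (f *S g) m ≡ (f′ *S g′) m
*S-cong≤ f f′ g g′ m ef eg =
  sumTo-cong≤ m (λ k k≤m → cong₂ _*_ (ef k k≤m) (eg (m ∸ k) (ℕP.m∸n≤m m k)))

-- The recursion (f g)_{n+1} = f₀ g_{n+1} + ((f ∘ suc) g)_n on which associativity rests.
*S-suc : ∀ f g n → (f *S g) (suc n) ≡ f 0 * g (suc n) + ((f ∘ suc) *S g) n
*S-suc f g n = sumTo-front n (λ k → f k * g (suc n ∸ k))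

*S-distribʳ : ∀ f g h → (f +S g) *S h ≗ f *S h +S g *S h
*S-distribʳ f g h n =
  trans (sumTo-cong n (λ k → ℤP.*-distribʳ-+ (h (n ∸ k)) (f k) (g k))) (sumTo-+ n _ _)

*S-comm : ∀ f g → f *S g ≗ g *S f
*S-comm f g n = trans (sumTo-reverse n _) (sumTo-cong≤ n (λ k k≤n →
  trans (cong (λ i → f (n ∸ k) * g i) (ℕP.m∸[m∸n]≡n k≤n)) (ℤP.*-comm (f (n ∸ k)) (g k))))

*S-distribˡ : ∀ f g h → f *S (g +S h) ≗ f *S g +S f *S h
*S-distribˡ f g h n = trans (*S-comm f (g +S h) n)
  (trans (*S-distribʳ g h f n) (cong₂ _+_ (*S-comm g f n) (*S-comm h f n)))

*S-scaleˡ : ∀ c f g → (λ k → c * f k) *S g ≗ (λ n → c * (f *S g) n)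
*S-scaleˡ c f g n =
  trans (sumTo-cong n (λ k → ℤP.*-assoc c (f k) (g (n ∸ k)))) (sym (sumTo-*ˡ n c _))

*S-zeroˡ : ∀ g → 0S *S g ≗ 0S
*S-zeroˡ g n = sumTo-zero n

*S-identityˡ : ∀ g → oneS *S g ≗ g
*S-identityˡ g zero    = ℤP.*-identityˡ (g 0)
*S-identityˡ g (suc n) = trans (*S-suc oneS g n)
  (trans (cong₂ _+_ (ℤP.*-identityˡ (g (suc n))) (*S-zeroˡ g n)) (ℤP.+-identityʳ _))

*S-assoc : ∀ f g h → (f *S g) *S h ≗ f *S (g *S h)
*S-assoc f g h zero    = ℤP.*-assoc (f 0) (g 0) (h 0)
*S-assoc f g h (suc n) = begin
  ((f *S g) *S h) (suc n)                                ≡⟨ *S-suc (f *S g) h n ⟩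
  f 0 * g 0 * h (suc n) + (((f *S g) ∘ suc) *S h) n
    ≡⟨ cong (f 0 * g 0 * h (suc n) +_) (*S-congˡ h (*S-suc f g) n) ⟩
  f 0 * g 0 * h (suc n) + (((λ k → f 0 * g (suc k)) +S (f ∘ suc) *S g) *S h) n
    ≡⟨ cong (f 0 * g 0 * h (suc n) +_) (*S-distribʳ (λ k → f 0 * g (suc k)) ((f ∘ suc) *S g) h n) ⟩
  f 0 * g 0 * h (suc n) + (((λ k → f 0 * g (suc k)) *S h) n + (((f ∘ suc) *S g) *S h) n)
    ≡⟨ cong₂ (λ a b → f 0 * g 0 * h (suc n) + (a + b))
             (*S-scaleˡ (f 0) (g ∘ suc) h n) (*S-assoc (f ∘ suc) g h n) ⟩
  f 0 * g 0 * h (suc n) + (f 0 * ((g ∘ suc) *S h) n + ((f ∘ suc) *S (g *S h)) n)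
    ≡⟨ regroup (f 0) (g 0) (h (suc n)) _ _ ⟩
  f 0 * (g 0 * h (suc n) + ((g ∘ suc) *S h) n) + ((f ∘ suc) *S (g *S h)) n
    ≡⟨ cong (λ x → f 0 * x + ((f ∘ suc) *S (g *S h)) n) (sym (*S-suc g h n)) ⟩
  f 0 * (g *S h) (suc n) + ((f ∘ suc) *S (g *S h)) n     ≡⟨ sym (*S-suc f (g *S h) n) ⟩
  (f *S (g *S h)) (suc n)                                ∎
  where
  open ≡-Reasoning
  regroup : ∀ a b c x y → a * b * c + (a * x + y) ≡ a * (b * c + x) + y
  regroup = ℤSolver.solve-∀

seriesRing : CommutativeRing _ _
seriesRing = record
  { Carrier = Series ; _≈_ = _≗_ ; _+_ = _+S_ ; _*_ = _*S_ ; -_ = -S_ ; 0# = 0S ; 1# = oneS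
  ; isCommutativeRing = record
    { isRing = record
      { +-isAbelianGroup = record
        { isGroup = record
          { isMonoid = record
            { isSemigroup = record
              { isMagma = record
                { isEquivalence = record
                  { refl = λ _ → refl ; sym = ≗-sym ; trans = λ e e′ n → trans (e n) (e′ n) }
                ; ∙-cong = +S-cong }
              ; assoc = λ f g h n → ℤP.+-assoc (f n) (g n) (h n) }
            ; identity = (λ f n → ℤP.+-identityˡ (f n)) , (λ f n → ℤP.+-identityʳ (f n)) }
          ; inverse = (λ f n → ℤP.+-inverseˡ (f n)) , (λ f n → ℤP.+-inverseʳ (f n))
          ; ⁻¹-cong = -S-cong }
        ; comm = λ f g n → ℤP.+-comm (f n) (g n) }
      ; *-cong = *S-cong
      ; *-assoc = *S-assoc
      ; *-identity = *S-identityˡ , (λ f n → trans (*S-comm f oneS n) (*S-identityˡ f n))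
      ; distrib = *S-distribˡ , (λ h f g → *S-distribʳ f g h) }
    ; *-comm = *S-comm } }

module ≗-Reasoning = Relation.Binary.Reasoning.Setoid (CommutativeRing.setoid seriesRing)

-- The integers embed into the series ring as constants; with this the
-- ring solver decides identities between series expressions with integer
-- constants ('solve', 'con', ':+', ':*', ':-', ':=').

constS-one : constS 1ℤ ≗ oneS
constS-one zero    = refl
constS-one (suc n) = refl

constS-homomorphism : ACR._-Raw-AlmostCommutative⟶_ ℤ.+-*-rawRing (ACR.fromCommutativeRing seriesRing)
constS-homomorphism = record
  { ⟦_⟧ = constS ; +-homo = +-homo ; *-homo = *-homo ; -‿homo = neg-homo
  ; 0-homo = zero-homo ; 1-homo = constS-one }
  where
  +-homo : ∀ c d → constS (c + d) ≗ constS c +S constS d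
  +-homo c d zero    = refl
  +-homo c d (suc n) = sym (ℤP.+-identityʳ 0ℤ)
  *-homo : ∀ c d → constS (c * d) ≗ constS c *S constS d
  *-homo c d zero    = refl
  *-homo c d (suc n) = sym (trans (*S-suc (constS c) (constS d) n)
    (trans (cong₂ _+_ (ℤP.*-zeroʳ c) (*S-zeroˡ (constS d) n)) refl))
  neg-homo : ∀ c → constS (- c) ≗ -S constS c
  neg-homo c zero    = refl
  neg-homo c (suc n) = refl
  zero-homo : constS 0ℤ ≗ 0S
  zero-homo zero    = refl
  zero-homo (suc n) = refl

constS-≟ : ∀ c d → Maybe (constS c ≗ constS d)
constS-≟ c d with c ℤ.≟ d
... | yes refl = just (λ _ → refl)
... | no _     = nothing

open import Algebra.Solver.Ring ℤ.+-*-rawRing (ACR.fromCommutativeRing seriesRing) constS-homomorphism constS-≟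
  using (solve; _:+_; _:*_; _:-_; :-_; _:=_; con)

-- q-adic order.  'Ord k f' says that q^k divides f, i.e. the first k
-- coefficients of f vanish; 'f ≡1mod k' says that f ≡ 1 modulo q^k.

Ord : ℕ → Series → Set
Ord k f = ∀ m → m ℕ.< k → f m ≡ 0ℤ

_≡1mod_ : Series → ℕ → Set
f ≡1mod k = Ord k (f +S -S oneS)

Ord-weaken : ∀ {j k f} → j ℕ.≤ k → Ord k f → Ord j f
Ord-weaken j≤k o m m<j = o m (ℕP.<-≤-trans m<j j≤k)

Ord-≗ : ∀ {k f g} → f ≗ g → Ord k f → Ord k g
Ord-≗ e o m m<k = trans (sym (e m)) (o m m<k)

Ord-neg : ∀ {k f} → Ord k f → Ord k (-S f)
Ord-neg o m m<k = cong -_ (o m m<k)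

Ord-* : ∀ {a b f g} → Ord a f → Ord b g → Ord (a ℕ.+ b) (f *S g)
Ord-* {a} {b} {f} {g} of og m m<a+b = trans (sumTo-cong≤ m term-vanishes) (sumTo-zero m)
  where
  term-vanishes : ∀ k → k ℕ.≤ m → f k * g (m ∸ k) ≡ 0ℤ
  term-vanishes k k≤m with ℕP.<-≤-connex k a
  ... | inj₁ k<a = cong (_* g (m ∸ k)) (of k k<a)
  ... | inj₂ a≤k = trans (cong (f k *_) (og (m ∸ k) (ℕP.≤-<-trans (ℕP.∸-monoʳ-≤ m a≤k) m∸a<b)))
                         (ℤP.*-zeroʳ (f k))
    where
    m∸a<b : m ∸ a ℕ.< b
    m∸a<b = ℕP.+-cancelˡ-< a _ _
      (subst (ℕ._< a ℕ.+ b) (sym (ℕP.m+[n∸m]≡n (ℕP.≤-trans a≤k k≤m))) m<a+b)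

Ord-*ˡ : ∀ {k f} g → Ord k f → Ord k (f *S g)
Ord-*ˡ {k} g of = subst (λ i → Ord i _) (ℕP.+-identityʳ k) (Ord-* {b = 0} {g = g} of (λ _ ()))

≡1mod-* : ∀ {k f g} → f ≡1mod k → g ≡1mod k → (f *S g) ≡1mod k
≡1mod-* {k} {f} {g} of og = Ord-≗ expand
  (λ m m<k → cong₂ _+_ (Ord-*ˡ g of m m<k) (og m m<k))
  where
  expand : (f +S -S oneS) *S g +S (g +S -S oneS) ≗ f *S g +S -S oneS
  expand = begin
    (f +S -S oneS) *S g +S (g +S -S oneS)
      ≈⟨ +S-cong (*S-congˡ g (+S-cong {f} (λ _ → refl) one)) (+S-cong {g} (λ _ → refl) one) ⟩
    (f +S -S constS 1ℤ) *S g +S (g +S -S constS 1ℤ)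
      ≈⟨ solve 2 (λ F G → (F :- con 1ℤ) :* G :+ (G :- con 1ℤ) := F :* G :- con 1ℤ) (λ _ → refl) f g ⟩
    f *S g +S -S constS 1ℤ
      ≈⟨ +S-cong {f *S g} (λ _ → refl) one ⟨
    f *S g +S -S oneS ∎
    where
    open ≗-Reasoning
    one : -S oneS ≗ -S constS 1ℤ
    one = -S-cong (≗-sym constS-one)

≡1mod-constant : ∀ {k f} → f ≡1mod suc k → f 0 ≡ 1ℤ
≡1mod-constant {f = f} o = trans (sym (cancel (f 0))) (cong (_+ 1ℤ) (o 0 (s≤s z≤n)))
  where
  cancel : ∀ x → (x + - 1ℤ) + 1ℤ ≡ x
  cancel = ℤSolver.solve-∀

mono-on : ∀ e c → mono e c e ≡ c
mono-on e c with e ≡ᵇ e | ℕP.≡⇒≡ᵇ e e refl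
... | true | _ = refl

mono-off : ∀ e c {m} → m ≢ e → mono e c m ≡ 0ℤ
mono-off e c {m} m≢e with m ≡ᵇ e | ℕP.≡ᵇ⇒≡ m e
... | true  | m≡e = contradiction (m≡e _) m≢e
... | false | _   = refl

Ord-mono : ∀ e c → Ord e (mono e c)
Ord-mono e c m m<e = mono-off e c (ℕP.<⇒≢ m<e)

mono-cong : ∀ {e e′ c c′} → e ≡ e′ → c ≡ c′ → mono e c ≗ mono e′ c′
mono-cong refl refl _ = refl

mono-zero-one : mono 0 1ℤ ≗ oneS
mono-zero-one zero    = refl
mono-zero-one (suc m) = refl

mono-neg : ∀ e c → mono e (- c) ≗ -S mono e c
mono-neg e c m with m ≡ᵇ e
... | true  = refl
... | false = refl

mono-*-shift : ∀ e c f m → (mono e c *S f) (e ℕ.+ m) ≡ c * f m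
mono-*-shift zero c f zero = refl
mono-*-shift zero c f (suc m) = trans (*S-suc (mono 0 c) f m)
  (trans (cong (c * f (suc m) +_) (trans (*S-congˡ {mono 0 c ∘ suc} {0S} f (λ _ → refl) m) (*S-zeroˡ f m)))
         (ℤP.+-identityʳ _))
mono-*-shift (suc e) c f m = trans (*S-suc (mono (suc e) c) f (e ℕ.+ m))
  (trans (cong (0ℤ * f (suc (e ℕ.+ m)) +_) (mono-*-shift e c f m)) (ℤP.+-identityˡ _))

mono-mono : ∀ a b c d → mono a c *S mono b d ≗ mono (a ℕ.+ b) (c * d)
mono-mono a b c d m with ℕP.<-≤-connex m a
... | inj₁ m<a = trans (Ord-*ˡ (mono b d) (Ord-mono a c) m m<a)
                       (sym (Ord-mono (a ℕ.+ b) (c * d) m (ℕP.<-≤-trans m<a (ℕP.m≤m+n a b))))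
... | inj₂ a≤m with ℕP.m≤n⇒∃[o]m+o≡n a≤m
...   | m′ , refl with m′ ℕ.≟ b
...     | yes refl = trans (mono-*-shift a c (mono b d) b)
                           (trans (cong (c *_) (mono-on b d)) (sym (mono-on (a ℕ.+ b) (c * d))))
...     | no m′≢b = trans (mono-*-shift a c (mono b d) m′)
                          (trans (trans (cong (c *_) (mono-off b d m′≢b)) (ℤP.*-zeroʳ c))
                                 (sym (mono-off (a ℕ.+ b) (c * d) (m′≢b ∘ ℕP.+-cancelˡ-≡ a _ _))))

-- Inverses.  'inv f' is the multiplicative inverse of a series f with
-- constant term 1; every property of inv needed below follows from
-- inv-right and associativity.

*S-identityʳ : ∀ f → f *S oneS ≗ f
*S-identityʳ f n = trans (*S-comm f oneS n) (*S-identityˡ f n)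

*S-constant-one : ∀ {f g} → f 0 ≡ 1ℤ → g 0 ≡ 1ℤ → (f *S g) 0 ≡ 1ℤ
*S-constant-one f0 g0 = cong₂ _*_ f0 g0

inv-stable : ∀ f N k → k ℕ.≤ N → invUpTo f N k ≡ inv f k
inv-stable f zero zero z≤n = refl
inv-stable f (suc N) k k≤1+N with ℕP.m≤n⇒m<n∨m≡n k≤1+N
... | inj₂ refl = refl
... | inj₁ (s≤s k≤N) with k ≤ᵇ N | ℕP.≤⇒≤ᵇ k≤N
...   | true | _ = inv-stable f N k k≤N

inv-suc : ∀ f n → inv f (suc n) ≡ - sumTo n (λ i → f (suc i) * inv f (n ∸ i))
inv-suc f n with n <ᵇ n | ℕP.<ᵇ⇒< n n
... | true  | n<n = contradiction (n<n _) (ℕP.<-irrefl refl)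
... | false | _   = cong -_ (sumTo-cong≤ n (λ i i≤n →
  cong (f (suc i) *_) (inv-stable f n (n ∸ i) (ℕP.m∸n≤m n i))))

inv-right : ∀ f → f 0 ≡ 1ℤ → f *S inv f ≗ oneS
inv-right f f0 zero rewrite f0 = refl
inv-right f f0 (suc n) = begin
  (f *S inv f) (suc n)              ≡⟨ *S-suc f (inv f) n ⟩
  f 0 * inv f (suc n) + S           ≡⟨ cong₂ (λ a b → a * b + S) f0 (inv-suc f n) ⟩
  1ℤ * (- S) + S                    ≡⟨ cancel S ⟩
  0ℤ                                ∎
  where
  open ≡-Reasoning
  S = sumTo n (λ k → f (suc k) * inv f (n ∸ k))
  cancel : ∀ x → 1ℤ * (- x) + x ≡ 0ℤ
  cancel = ℤSolver.solve-∀

inv-left : ∀ f → f 0 ≡ 1ℤ → inv f *S f ≗ oneS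
inv-left f f0 n = trans (*S-comm (inv f) f n) (inv-right f f0 n)

inv-unique : ∀ f g h → f 0 ≡ 1ℤ → f *S g ≗ h → g ≗ inv f *S h
inv-unique f g h f0 e = begin
  g                     ≈⟨ *S-identityˡ g ⟨
  oneS *S g             ≈⟨ *S-congˡ g (inv-left f f0) ⟨
  (inv f *S f) *S g     ≈⟨ *S-assoc (inv f) f g ⟩
  inv f *S (f *S g)     ≈⟨ *S-congʳ (inv f) e ⟩
  inv f *S h            ∎
  where open ≗-Reasoning

cancelˡ : ∀ d x y → d 0 ≡ 1ℤ → d *S x ≗ d *S y → x ≗ y
cancelˡ d x y d0 e = begin
  x                     ≈⟨ inv-unique d x (d *S y) d0 e ⟩
  inv d *S (d *S y)     ≈⟨ *S-assoc (inv d) d y ⟨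
  (inv d *S d) *S y     ≈⟨ *S-congˡ y (inv-left d d0) ⟩
  oneS *S y             ≈⟨ *S-identityˡ y ⟩
  y                     ∎
  where open ≗-Reasoning

inv-cong : ∀ f g → f 0 ≡ 1ℤ → g 0 ≡ 1ℤ → f ≗ g → inv f ≗ inv g
inv-cong f g f0 g0 e = cancelˡ f (inv f) (inv g) f0 (λ n →
  trans (inv-right f f0 n) (sym (trans (*S-congˡ (inv g) e n) (inv-right g g0 n))))

inv-* : ∀ f g → f 0 ≡ 1ℤ → g 0 ≡ 1ℤ → inv (f *S g) ≗ inv f *S inv g
inv-* f g f0 g0 = ≗-sym (cancelˡ (f *S g) _ _ fg0 (λ n →
  trans (product-inverse n) (sym (inv-right (f *S g) fg0 n))))
  where
  fg0 : (f *S g) 0 ≡ 1ℤ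
  fg0 = *S-constant-one {f} {g} f0 g0
  product-inverse : (f *S g) *S (inv f *S inv g) ≗ oneS
  product-inverse = begin
    (f *S g) *S (inv f *S inv g)
      ≈⟨ solve 4 (λ a b c d → (a :* b) :* (c :* d) := (a :* c) :* (b :* d)) (λ _ → refl) f g (inv f) (inv g) ⟩
    (f *S inv f) *S (g *S inv g)    ≈⟨ *S-cong (inv-right f f0) (inv-right g g0) ⟩
    oneS *S oneS                    ≈⟨ *S-identityˡ oneS ⟩
    oneS                            ∎
    where open ≗-Reasoning

clear-denominator : ∀ M D E N → D 0 ≡ 1ℤ → M ≗ D *S E → M *S (N *S inv D) ≗ E *S N
clear-denominator M D E N d0 me = begin
  M *S (N *S inv D)                ≈⟨ *S-congˡ (N *S inv D) me ⟩
  (D *S E) *S (N *S inv D)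
    ≈⟨ solve 4 (λ D E N D⁻¹ → (D :* E) :* (N :* D⁻¹) := (D :* D⁻¹) :* (E :* N)) (λ _ → refl) D E N (inv D) ⟩
  (D *S inv D) *S (E *S N)         ≈⟨ *S-congˡ (E *S N) (inv-right D d0) ⟩
  oneS *S (E *S N)                 ≈⟨ *S-identityˡ (E *S N) ⟩
  E *S N                           ∎
  where open ≗-Reasoning

-- q-Pochhammer symbols.  Each factor 1 - q^e is ≡ 1 modulo q^e, which
-- gives the constant term of finite products and the stabilisation of the
-- coefficients that defines the infinite products.

oneMinus-expand : ∀ e → oneMinus e ≗ constS 1ℤ +S -S mono e 1ℤ
oneMinus-expand e zero    = refl
oneMinus-expand e (suc m) = refl

oneMinus-cong : ∀ {e e′} → e ≡ e′ → oneMinus e ≗ oneMinus e′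
oneMinus-cong refl _ = refl

oneMinus-≡1mod : ∀ e → oneMinus e ≡1mod e
oneMinus-≡1mod e m m<e = trans (cong (λ x → (oneS m + - x) + - oneS m) (Ord-mono e 1ℤ m m<e))
                               (cancel (oneS m))
  where
  cancel : ∀ x → (x + - 0ℤ) + - x ≡ 0ℤ
  cancel = ℤSolver.solve-∀

poch-≡1mod : ∀ a s N → poch a s N ≡1mod a
poch-≡1mod a s zero    m _ = ℤP.+-inverseʳ (oneS m)
poch-≡1mod a s (suc N) =
  ≡1mod-* {a} {poch a s N} {oneMinus (a ℕ.+ s ℕ.* N)} (poch-≡1mod a s N)
          (Ord-weaken (ℕP.m≤m+n a (s ℕ.* N)) (oneMinus-≡1mod (a ℕ.+ s ℕ.* N)))

poch-constant : ∀ a s N → poch (suc a) s N 0 ≡ 1ℤ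
poch-constant a s N = ≡1mod-constant {f = poch (suc a) s N} (Ord-weaken (s≤s z≤n) (poch-≡1mod (suc a) s N))

*S-oneMinus-below : ∀ f e m → m ℕ.< e → (f *S oneMinus e) m ≡ f m
*S-oneMinus-below f e m m<e = begin
  (f *S oneMinus e) m                               ≡⟨ *S-congʳ f (oneMinus-expand e) m ⟩
  (f *S (constS 1ℤ +S -S mono e 1ℤ)) m
    ≡⟨ solve 2 (λ F X → F :* (con 1ℤ :- X) := F :- X :* F) (λ _ → refl) f (mono e 1ℤ) m ⟩
  f m + - (mono e 1ℤ *S f) m                        ≡⟨ cong (λ x → f m + - x) (Ord-*ˡ f (Ord-mono e 1ℤ) m m<e) ⟩
  f m + - 0ℤ                                        ≡⟨ ℤP.+-identityʳ (f m) ⟩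
  f m                                               ∎
  where open ≡-Reasoning

poch-stable : ∀ a s {m M N} → m ℕ.≤ M → M ℕ.≤ N → poch (suc a) (suc s) N m ≡ poch (suc a) (suc s) M m
poch-stable a s {N = zero} m≤M z≤n = refl
poch-stable a s {m} {M} {suc N} m≤M M≤1+N with ℕP.m≤n⇒m<n∨m≡n M≤1+N
... | inj₂ refl = refl
... | inj₁ (s≤s M≤N) =
  trans (*S-oneMinus-below (poch (suc a) (suc s) N) _ m (s≤s m≤a+sN)) (poch-stable a s m≤M M≤N)
  where
  m≤a+sN : m ℕ.≤ a ℕ.+ suc s ℕ.* N
  m≤a+sN = ℕP.≤-trans (ℕP.≤-trans m≤M M≤N)
             (ℕP.≤-trans (ℕP.m≤n*m N (suc s)) (ℕP.m≤n+m (suc s ℕ.* N) a))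

pochInf-stable : ∀ a s {m M} → m ℕ.≤ M → pochInf (suc a) (suc s) m ≡ poch (suc a) (suc s) M m
pochInf-stable a s {m} m≤M =
  trans (poch-stable a s ℕP.≤-refl (ℕP.n≤1+n m)) (sym (poch-stable a s ℕP.≤-refl m≤M))

poch-front : ∀ a s n → poch a s (suc n) ≗ oneMinus a *S poch (a ℕ.+ s) s n
poch-front a s zero = begin
  oneS *S oneMinus (a ℕ.+ s ℕ.* 0)     ≈⟨ *S-identityˡ _ ⟩
  oneMinus (a ℕ.+ s ℕ.* 0)
    ≈⟨ oneMinus-cong (trans (cong (a ℕ.+_) (ℕP.*-zeroʳ s)) (ℕP.+-identityʳ a)) ⟩
  oneMinus a                           ≈⟨ *S-identityʳ (oneMinus a) ⟨
  oneMinus a *S oneS                   ∎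
  where open ≗-Reasoning
poch-front a s (suc n) = begin
  poch a s (suc n) *S oneMinus (a ℕ.+ s ℕ.* suc n)
    ≈⟨ *S-cong (poch-front a s n) (oneMinus-cong exponent) ⟩
  (oneMinus a *S poch (a ℕ.+ s) s n) *S oneMinus (a ℕ.+ s ℕ.+ s ℕ.* n)
    ≈⟨ *S-assoc (oneMinus a) (poch (a ℕ.+ s) s n) (oneMinus (a ℕ.+ s ℕ.+ s ℕ.* n)) ⟩
  oneMinus a *S poch (a ℕ.+ s) s (suc n) ∎
  where
  open ≗-Reasoning
  exponent : a ℕ.+ s ℕ.* suc n ≡ a ℕ.+ s ℕ.+ s ℕ.* n
  exponent = trans (cong (a ℕ.+_) (ℕP.*-suc s n)) (sym (ℕP.+-assoc a s (s ℕ.* n)))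

-- Infinite sums.  'sumInf G' is the sum of the family G when the k-th
-- term has order at least k ('Summable G'), which holds for every sum below.

Summable : (ℕ → Series) → Set
Summable G = ∀ k → Ord k (G k)

sumInf-cong : ∀ (G G′ : ℕ → Series) → (∀ k → G k ≗ G′ k) → sumInf G ≗ sumInf G′
sumInf-cong G G′ e m = sumTo-cong m (λ k → e k m)

sumInf-+ : ∀ (G G′ : ℕ → Series) → sumInf (λ k → G k +S G′ k) ≗ sumInf G +S sumInf G′
sumInf-+ G G′ m = sumTo-+ m _ _

sumInf-neg : ∀ (G : ℕ → Series) → sumInf (λ k → -S G k) ≗ -S sumInf G
sumInf-neg G m = sym (sumTo-neg m _)

sumInf-*ˡ : ∀ H (G : ℕ → Series) → Summable G → H *S sumInf G ≗ sumInf (λ k → H *S G k)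
sumInf-*ˡ H G summable n = begin
  sumTo n (λ i → H i * sumTo (n ∸ i) (λ k → G k (n ∸ i)))
    ≡⟨ sumTo-cong≤ n (λ i i≤n → cong (H i *_) (pad i i≤n)) ⟩
  sumTo n (λ i → H i * sumTo n (λ k → G k (n ∸ i)))
    ≡⟨ sumTo-cong n (λ i → sumTo-*ˡ n (H i) _) ⟩
  sumTo n (λ i → sumTo n (λ k → H i * G k (n ∸ i)))
    ≡⟨ sumTo-swap n n _ ⟩
  sumTo n (λ k → sumTo n (λ i → H i * G k (n ∸ i))) ∎
  where
  open ≡-Reasoning
  pad : ∀ i → i ℕ.≤ n → sumTo (n ∸ i) (λ k → G k (n ∸ i)) ≡ sumTo n (λ k → G k (n ∸ i))
  pad i i≤n = trans (sumTo-pad (n ∸ i) _ (λ k lt → summable k (n ∸ i) lt) i)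
                    (cong (λ x → sumTo x (λ k → G k (n ∸ i))) (ℕP.m∸n+n≡m i≤n))

sumInf-front : ∀ (G : ℕ → Series) → Summable G → sumInf G ≗ G 0 +S sumInf (G ∘ suc)
sumInf-front G summable zero =
  sym (trans (cong (G 0 0 +_) (summable 1 0 (s≤s z≤n))) (ℤP.+-identityʳ _))
sumInf-front G summable (suc m) = trans (sumTo-front m (λ k → G k (suc m)))
  (cong (G 0 (suc m) +_) (sym (trans (cong (sumTo m (λ k → G (suc k) (suc m)) +_)
                                           (summable (suc (suc m)) (suc m) ℕP.≤-refl))
                                     (ℤP.+-identityʳ _))))

Ord-sumInf : ∀ c (G : ℕ → Series) → (∀ k → Ord c (G k)) → Ord c (sumInf G)
Ord-sumInf c G o m m<c = trans (sumTo-cong m (λ k → o k m m<c)) (sumTo-zero m)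

sumInf-telescope : ∀ (T r : ℕ → Series) → (∀ k → Ord (suc k) (r k)) →
                   T 0 ≗ -S r 0 → (∀ n → T (suc n) ≗ r n +S -S r (suc n)) → sumInf T ≗ 0S
sumInf-telescope T r r-ord T0 Tsuc m = trans (partial m m) (cong -_ (r-ord m m ℕP.≤-refl))
  where
  cancel : ∀ a b → - a + (a + - b) ≡ - b
  cancel = ℤSolver.solve-∀
  partial : ∀ N x → sumTo N (λ k → T k x) ≡ - r N x
  partial zero    x = T0 x
  partial (suc N) x = trans (cong₂ _+_ (partial N x) (Tsuc N x)) (cancel (r N x) (r (suc N) x))

difference-zero : ∀ {x y} → x + - y ≡ 0ℤ → x ≡ y
difference-zero {x} {y} e = trans (sym (restore x y)) (trans (cong (_+ y) e) (ℤP.+-identityˡ y))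
  where
  restore : ∀ x y → (x + - y) + y ≡ x
  restore = ℤSolver.solve-∀

stable-family-one : (G : ℕ → Series) → (∀ j → G j ≗ G (suc j)) → (∀ j → G j ≡1mod suc j) →
                    ∀ j → G j ≗ oneS
stable-family-one G step close j m =
  trans (shift m) (difference-zero (close (j ℕ.+ m) m (s≤s (ℕP.m≤n+m m j))))
  where
  shift : ∀ d → G j m ≡ G (j ℕ.+ d) m
  shift zero    = cong (λ i → G i m) (sym (ℕP.+-identityʳ j))
  shift (suc d) = trans (shift d) (trans (step (j ℕ.+ d) m) (cong (λ i → G i m) (sym (ℕP.+-suc j d))))

contraction-zero : (D f : ℕ → Series) → (∀ j → Ord 1 (f j)) → (∀ j → D j ≗ f j *S D (suc j)) →
                   ∀ j → D j ≗ 0S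
contraction-zero D f f-ord step j m = D-ord (suc m) j m ℕP.≤-refl
  where
  D-ord : ∀ k j → Ord k (D j)
  D-ord zero    j = λ _ ()
  D-ord (suc k) j = Ord-≗ (≗-sym (step j)) (Ord-* (f-ord j) (D-ord k (suc j)))

-- The core identity, proved in the variable x = q^s for an arbitrary step
-- s = t + 1 ≥ 1 (the theorem uses s = 3).
module InVariable (t : ℕ) where

  s : ℕ
  s = suc t

  x^ : ℕ → Series
  x^ e = mono (s ℕ.* e) 1ℤ

  1-x^ : ℕ → Series
  1-x^ e = oneMinus (s ℕ.* e)

  x^-cong : ∀ {a b} → a ≡ b → x^ a ≗ x^ b
  x^-cong refl _ = refl

  x^-+ : ∀ a b → x^ a *S x^ b ≗ x^ (a ℕ.+ b)
  x^-+ a b n = trans (mono-mono (s ℕ.* a) (s ℕ.* b) 1ℤ 1ℤ n) (mono-cong (sym (ℕP.*-distribˡ-+ s a b)) refl n)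

  x^-Ord : ∀ e → Ord (s ℕ.* e) (x^ e)
  x^-Ord e = Ord-mono (s ℕ.* e) 1ℤ

  1-x^-cong : ∀ {a b} → a ≡ b → 1-x^ a ≗ 1-x^ b
  1-x^-cong refl _ = refl

  1-x^-expand : ∀ e → 1-x^ e ≗ constS 1ℤ +S -S x^ e
  1-x^-expand e = oneMinus-expand (s ℕ.* e)

  Q : ℕ → Series
  Q n = poch s s n

  Z : ℕ → ℕ → Series
  Z j n = poch (s ℕ.* suc j) s n

  P∞ : ℕ → Series
  P∞ j = pochInf (s ℕ.* suc j) s

  QZ-constant : ∀ j n → (Q n *S Z j n) 0 ≡ 1ℤ
  QZ-constant j n = *S-constant-one {Q n} {Z j n} (poch-constant t s n) (poch-constant (j ℕ.+ t ℕ.* suc j) s n)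

  Q-suc : ∀ n → Q (suc n) ≗ Q n *S 1-x^ (suc n)
  Q-suc n = *S-congʳ (Q n) (oneMinus-cong (sym (ℕP.*-suc s n)))

  Z-suc : ∀ j n → Z j (suc n) ≗ Z j n *S 1-x^ (suc j ℕ.+ n)
  Z-suc j n = *S-congʳ (Z j n) (oneMinus-cong (sym (ℕP.*-distribˡ-+ s (suc j) n)))

  Z-front : ∀ j n → Z j (suc n) ≗ 1-x^ (suc j) *S Z (suc j) n
  Z-front j n m = trans (poch-front (s ℕ.* suc j) s n m)
    (*S-congʳ (1-x^ (suc j)) (λ k → cong (λ a → poch a s n k) (exponent s j)) m)
    where
    exponent : ∀ s j → s ℕ.* suc j ℕ.+ s ≡ s ℕ.* suc (suc j)
    exponent = ℕSolver.solve-∀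

  Q-front : ∀ n → Q (suc n) ≗ 1-x^ 1 *S Z 1 n
  Q-front n m = trans (poch-front s s n m)
    (*S-cong (oneMinus-cong (exponent₁ s)) (λ k → cong (λ a → poch a s n k) (exponent₂ s)) m)
    where
    exponent₁ : ∀ s → s ≡ s ℕ.* 1
    exponent₁ = ℕSolver.solve-∀
    exponent₂ : ∀ s → s ℕ.+ s ≡ s ℕ.* 2
    exponent₂ = ℕSolver.solve-∀

  P∞-peel : ∀ j → P∞ j ≗ 1-x^ (suc j) *S P∞ (suc j)
  P∞-peel j m = trans (Z-front j m m)
    (*S-cong≤ (1-x^ (suc j)) (1-x^ (suc j)) (Z (suc j) m) (P∞ (suc j)) m (λ _ _ → refl)
      (λ k k≤m → sym (pochInf-stable (suc j ℕ.+ t ℕ.* suc (suc j)) t k≤m)))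

  P∞-≡1mod : ∀ j → P∞ j ≡1mod (s ℕ.* suc j)
  P∞-≡1mod j m = poch-≡1mod (s ℕ.* suc j) s (suc m) m

  n≤n*n : ∀ n → n ℕ.≤ n ℕ.* n
  n≤n*n zero    = z≤n
  n≤n*n (suc n) = ℕP.m≤m*n (suc n) (suc n)

  frac : ℕ → Series → Series
  frac e D = x^ e *S inv D

  frac-Ord : ∀ {k} e D → k ℕ.≤ s ℕ.* e → Ord k (frac e D)
  frac-Ord e D k≤se = Ord-weaken k≤se (Ord-*ˡ (inv D) (x^-Ord e))

  frac-summand : ∀ {k} e D → k ℕ.≤ e → Ord k (frac e D)
  frac-summand e D k≤e = frac-Ord e D (ℕP.≤-trans k≤e (ℕP.m≤n*m e s))

  frac-one : ∀ e → frac e (oneS *S oneS) ≗ x^ e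
  frac-one e = begin
    x^ e *S inv (oneS *S oneS)   ≈⟨ *S-congʳ (x^ e) inv-one ⟩
    x^ e *S oneS                 ≈⟨ *S-identityʳ (x^ e) ⟩
    x^ e                         ∎
    where
    open ≗-Reasoning
    inv-one : inv (oneS *S oneS) ≗ oneS
    inv-one = ≗-sym (cancelˡ (oneS *S oneS) oneS (inv (oneS *S oneS)) refl (λ n →
      trans (*S-identityʳ (oneS *S oneS) n) (trans (*S-identityˡ oneS n) (sym (inv-right (oneS *S oneS) refl n)))))

  F-term : ℕ → ℕ → Series
  F-term j n = frac (j ℕ.* n ℕ.+ n ℕ.* n) (Q n *S Z j n)

  F : ℕ → Series
  F j = sumInf (F-term j)

  F-summable : ∀ j → Summable (F-term j)
  F-summable j n = frac-summand _ _ (ℕP.≤-trans (n≤n*n n) (ℕP.m≤n+m (n ℕ.* n) (j ℕ.* n)))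

  F-term-zero : ∀ j → F-term j 0 ≗ constS 1ℤ
  F-term-zero j m =
    trans (frac-one _ m) (trans (mono-cong (vanish s j) refl m) (trans (mono-zero-one m) (sym (constS-one m))))
    where
    vanish : ∀ s j → s ℕ.* (j ℕ.* 0 ℕ.+ 0 ℕ.* 0) ≡ 0
    vanish = ℕSolver.solve-∀

  -- (1 - x^{j+1}) F j = F (j+1), by telescoping: the remainders
  --   r j n = x^{j(n+1) + (n+1)²} / ((x; x)_n (x^{j+2}; x)_n)
  -- satisfy (1 - x^{j+1}) F-term j n - F-term (j+1) n = r j (n-1) - r j n.
  F-remainder : ℕ → ℕ → Series
  F-remainder j n = frac (j ℕ.* suc n ℕ.+ suc n ℕ.* suc n) (Q n *S Z (suc j) n)

  F-remainder-Ord : ∀ j n → Ord (suc n) (F-remainder j n)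
  F-remainder-Ord j n = frac-summand _ _ (ℕP.≤-trans (n≤n*n (suc n)) (ℕP.m≤n+m _ (j ℕ.* suc n)))

  F-difference : ℕ → ℕ → Series
  F-difference j n = 1-x^ (suc j) *S F-term j n +S -S F-term (suc j) n

  F-difference-zero : ∀ j → F-difference j 0 ≗ -S F-remainder j 0
  F-difference-zero j = begin
    1-x^ (suc j) *S F-term j 0 +S -S F-term (suc j) 0
      ≈⟨ +S-cong (*S-congʳ (1-x^ (suc j)) (F-term-zero j)) (-S-cong (F-term-zero (suc j))) ⟩
    1-x^ (suc j) *S constS 1ℤ +S -S constS 1ℤ
      ≈⟨ +S-cong (*S-congˡ (constS 1ℤ) (1-x^-expand (suc j))) (λ _ → refl) ⟩
    (constS 1ℤ +S -S x^ (suc j)) *S constS 1ℤ +S -S constS 1ℤ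
      ≈⟨ solve 1 (λ w → (con 1ℤ :- w) :* con 1ℤ :- con 1ℤ := :- w) (λ _ → refl) (x^ (suc j)) ⟩
    -S x^ (suc j)
      ≈⟨ -S-cong (λ m → trans (frac-one _ m) (x^-cong (exponent j) m)) ⟨
    -S F-remainder j 0 ∎
    where
    open ≗-Reasoning
    exponent : ∀ j → j ℕ.* 1 ℕ.+ 1 ℕ.* 1 ≡ suc j
    exponent = ℕSolver.solve-∀

  F-common : ℕ → ℕ → Series
  F-common j n = Q n *S Z (suc j) n *S 1-x^ (suc n) *S 1-x^ (suc j ℕ.+ suc n) *S 1-x^ (suc j)

  F-common-constant : ∀ j n → F-common j n 0 ≡ 1ℤ
  F-common-constant j n = cong (λ c → c * 1ℤ * 1ℤ * 1ℤ) (QZ-constant (suc j) n)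

  F-common-term : ∀ j n → F-common j n ≗ (Q (suc n) *S Z j (suc n)) *S 1-x^ (suc j ℕ.+ suc n)
  F-common-term j n = begin
    F-common j n
      ≈⟨ solve 5 (λ Q Z U V W → Q :* Z :* U :* V :* W := ((Q :* U) :* (W :* Z)) :* V)
               (λ _ → refl) (Q n) (Z (suc j) n) (1-x^ (suc n)) V (1-x^ (suc j)) ⟩
    ((Q n *S 1-x^ (suc n)) *S (1-x^ (suc j) *S Z (suc j) n)) *S V
      ≈⟨ *S-congˡ V (*S-cong (Q-suc n) (Z-front j n)) ⟨
    (Q (suc n) *S Z j (suc n)) *S V ∎
    where
    open ≗-Reasoning
    V = 1-x^ (suc j ℕ.+ suc n)

  F-common-term′ : ∀ j n → F-common j n ≗ (Q (suc n) *S Z (suc j) (suc n)) *S 1-x^ (suc j)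
  F-common-term′ j n = begin
    F-common j n
      ≈⟨ solve 5 (λ Q Z U V W → Q :* Z :* U :* V :* W := ((Q :* U) :* (Z :* V)) :* W)
               (λ _ → refl) (Q n) (Z (suc j) n) (1-x^ (suc n)) V (1-x^ (suc j)) ⟩
    ((Q n *S 1-x^ (suc n)) *S (Z (suc j) n *S V)) *S 1-x^ (suc j)
      ≈⟨ *S-congˡ (1-x^ (suc j)) (*S-cong (Q-suc n) Z-last) ⟨
    (Q (suc n) *S Z (suc j) (suc n)) *S 1-x^ (suc j) ∎
    where
    open ≗-Reasoning
    V = 1-x^ (suc j ℕ.+ suc n)
    Z-last : Z (suc j) (suc n) ≗ Z (suc j) n *S V
    Z-last m = trans (Z-suc (suc j) n m) (*S-congʳ (Z (suc j) n) (1-x^-cong (sym (ℕP.+-suc (suc j) n))) m)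

  -- After multiplying by M the step is a polynomial identity in X = x^e,
  -- u = x^{n+1}, v = x^{j+n+2}, w = x^{j+1}, with e = j(n+1) + (n+1)².
  F-difference-suc : ∀ j n → F-difference j (suc n) ≗ F-remainder j n +S -S F-remainder j (suc n)
  F-difference-suc j n = cancelˡ M _ _ (F-common-constant j n) cleared
    where
    open ≗-Reasoning
    M = F-common j n
    U = 1-x^ (suc n)
    V = 1-x^ (suc j ℕ.+ suc n)
    W = 1-x^ (suc j)
    u = x^ (suc n)
    v = x^ (suc j ℕ.+ suc n)
    w = x^ (suc j)
    e = j ℕ.* suc n ℕ.+ suc n ℕ.* suc n
    X = x^ e
    exponent₁ : ∀ j n → suc j ℕ.* suc n ℕ.+ suc n ℕ.* suc n ≡ (j ℕ.* suc n ℕ.+ suc n ℕ.* suc n) ℕ.+ suc n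
    exponent₁ = ℕSolver.solve-∀
    exponent₂ : ∀ j n → j ℕ.* suc (suc n) ℕ.+ suc (suc n) ℕ.* suc (suc n)
                        ≡ ((j ℕ.* suc n ℕ.+ suc n ℕ.* suc n) ℕ.+ suc n) ℕ.+ (suc j ℕ.+ suc n)
    exponent₂ = ℕSolver.solve-∀
    D′ = Q (suc n) *S Z (suc j) (suc n)
    e′ = suc j ℕ.* suc n ℕ.+ suc n ℕ.* suc n
    e″ = j ℕ.* suc (suc n) ℕ.+ suc (suc n) ℕ.* suc (suc n)
    MA : M *S F-term j (suc n) ≗ V *S X
    MA = clear-denominator M (Q (suc n) *S Z j (suc n)) V X (QZ-constant j (suc n)) (F-common-term j n)
    MA′ : M *S F-term (suc j) (suc n) ≗ W *S (X *S u)
    MA′ m = trans (clear-denominator M D′ W (x^ e′) (QZ-constant (suc j) (suc n)) (F-common-term′ j n) m)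
                  (*S-congʳ W (λ k → trans (x^-cong (exponent₁ j n) k) (sym (x^-+ e (suc n) k))) m)
    Mr : M *S F-remainder j n ≗ (U *S V *S W) *S X
    Mr = clear-denominator M (Q n *S Z (suc j) n) (U *S V *S W) X (QZ-constant (suc j) n)
      (solve 5 (λ Q Z U V W → Q :* Z :* U :* V :* W := (Q :* Z) :* (U :* V :* W))
               (λ _ → refl) (Q n) (Z (suc j) n) U V W)
    Mr′ : M *S F-remainder j (suc n) ≗ W *S (X *S u *S v)
    Mr′ m = trans (clear-denominator M D′ W (x^ e″) (QZ-constant (suc j) (suc n)) (F-common-term′ j n) m)
      (*S-congʳ W (λ k → trans (x^-cong (exponent₂ j n) k)
                      (sym (trans (*S-congˡ v (x^-+ e (suc n)) k) (x^-+ (e ℕ.+ suc n) (suc j ℕ.+ suc n) k)))) m)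
    expand : ∀ {a} → 1-x^ a ≗ constS 1ℤ +S -S x^ a
    expand {a} = 1-x^-expand a
    cleared : M *S F-difference j (suc n) ≗ M *S (F-remainder j n +S -S F-remainder j (suc n))
    cleared = begin
      M *S (W *S F-term j (suc n) +S -S F-term (suc j) (suc n))
        ≈⟨ solve 4 (λ M W A A′ → M :* (W :* A :- A′) := W :* (M :* A) :- M :* A′)
                 (λ _ → refl) M W (F-term j (suc n)) (F-term (suc j) (suc n)) ⟩
      W *S (M *S F-term j (suc n)) +S -S (M *S F-term (suc j) (suc n))
        ≈⟨ +S-cong (*S-congʳ W MA) (-S-cong MA′) ⟩
      W *S (V *S X) +S -S (W *S (X *S u))
        ≈⟨ +S-cong (*S-cong expand (*S-congˡ X expand)) (-S-cong (*S-congˡ (X *S u) expand)) ⟩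
      (constS 1ℤ +S -S w) *S ((constS 1ℤ +S -S v) *S X) +S -S ((constS 1ℤ +S -S w) *S (X *S u))
        ≈⟨ solve 4 (λ X u v w → (con 1ℤ :- w) :* ((con 1ℤ :- v) :* X) :- (con 1ℤ :- w) :* (X :* u)
                           := ((con 1ℤ :- u) :* (con 1ℤ :- v) :* (con 1ℤ :- w)) :* X :- (con 1ℤ :- w) :* (X :* u :* v))
                 (λ _ → refl) X u v w ⟩
      ((constS 1ℤ +S -S u) *S (constS 1ℤ +S -S v) *S (constS 1ℤ +S -S w)) *S X
        +S -S ((constS 1ℤ +S -S w) *S (X *S u *S v))
        ≈⟨ +S-cong (*S-congˡ X (*S-cong (*S-cong expand expand) expand)) (-S-cong (*S-congˡ (X *S u *S v) expand)) ⟨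
      (U *S V *S W) *S X +S -S (W *S (X *S u *S v))
        ≈⟨ +S-cong Mr (-S-cong Mr′) ⟨
      M *S F-remainder j n +S -S (M *S F-remainder j (suc n))
        ≈⟨ solve 3 (λ M r r′ → M :* (r :- r′) := M :* r :- M :* r′)
                 (λ _ → refl) M (F-remainder j n) (F-remainder j (suc n)) ⟨
      M *S (F-remainder j n +S -S F-remainder j (suc n)) ∎

  F-shift : ∀ j → 1-x^ (suc j) *S F j ≗ F (suc j)
  F-shift j m = difference-zero (trans (sym (split m)) (telescope m))
    where
    open ≗-Reasoning
    telescope : sumInf (F-difference j) ≗ 0S
    telescope = sumInf-telescope (F-difference j) (F-remainder j) (F-remainder-Ord j)
                                 (F-difference-zero j) (F-difference-suc j)
    split : sumInf (F-difference j) ≗ 1-x^ (suc j) *S F j +S -S F (suc j)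
    split = begin
      sumInf (F-difference j)
        ≈⟨ sumInf-+ (λ k → 1-x^ (suc j) *S F-term j k) (λ k → -S F-term (suc j) k) ⟩
      sumInf (λ k → 1-x^ (suc j) *S F-term j k) +S sumInf (λ k → -S F-term (suc j) k)
        ≈⟨ +S-cong (≗-sym (sumInf-*ˡ (1-x^ (suc j)) (F-term j) (F-summable j))) (sumInf-neg (F-term (suc j))) ⟩
      1-x^ (suc j) *S F j +S -S F (suc j) ∎

  -- F j ≡ 1 modulo x^{j+1}: all terms but the first have order ≥ j + 1 in x.
  F-≡1mod : ∀ j → F j ≡1mod (s ℕ.* suc j)
  F-≡1mod j m m<sj = begin
    F j m + - oneS m
      ≡⟨ cong (_+ - oneS m) (sumInf-front (F-term j) (F-summable j) m) ⟩
    (F-term j 0 m + sumInf (F-term j ∘ suc) m) + - oneS m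
      ≡⟨ cong (λ a → (a + sumInf (F-term j ∘ suc) m) + - oneS m) (trans (F-term-zero j m) (constS-one m)) ⟩
    (oneS m + sumInf (F-term j ∘ suc) m) + - oneS m
      ≡⟨ cancel (oneS m) _ ⟩
    sumInf (F-term j ∘ suc) m
      ≡⟨ Ord-sumInf (s ℕ.* suc j) (F-term j ∘ suc) (λ k → frac-Ord _ _ (ℕP.*-monoʳ-≤ s (bound k))) m m<sj ⟩
    0ℤ ∎
    where
    open ≡-Reasoning
    cancel : ∀ a b → (a + b) + - a ≡ b
    cancel = ℤSolver.solve-∀
    bound : ∀ k → suc j ℕ.≤ j ℕ.* suc k ℕ.+ suc k ℕ.* suc k
    bound k = ℕP.≤-trans (ℕP.≤-reflexive (ℕP.+-comm 1 j)) (ℕP.+-mono-≤ (ℕP.m≤m*n j (suc k)) (s≤s z≤n))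

  -- (x^{j+1}; x)_∞ F j = 1: the product is independent of j (by F-shift) and
  -- ≡ 1 modulo x^{j+1}.
  P∞-F : ∀ j → P∞ j *S F j ≗ oneS
  P∞-F = stable-family-one (λ j → P∞ j *S F j) step close
    where
    step : ∀ j → P∞ j *S F j ≗ P∞ (suc j) *S F (suc j)
    step j = begin
      P∞ j *S F j                                  ≈⟨ *S-congˡ (F j) (P∞-peel j) ⟩
      (1-x^ (suc j) *S P∞ (suc j)) *S F j
        ≈⟨ solve 3 (λ W P F → (W :* P) :* F := P :* (W :* F)) (λ _ → refl) (1-x^ (suc j)) (P∞ (suc j)) (F j) ⟩
      P∞ (suc j) *S (1-x^ (suc j) *S F j)          ≈⟨ *S-congʳ (P∞ (suc j)) (F-shift j) ⟩
      P∞ (suc j) *S F (suc j)                      ∎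
      where open ≗-Reasoning
    close : ∀ j → (P∞ j *S F j) ≡1mod suc j
    close j = Ord-weaken (ℕP.m≤n*m (suc j) s) (≡1mod-* {s ℕ.* suc j} {P∞ j} {F j} (P∞-≡1mod j) (F-≡1mod j))

  K-term : ℕ → ℕ → Series
  K-term j n = frac (j ℕ.* n ℕ.+ n ℕ.* n ℕ.+ n) (Q n *S Z j n)

  K : ℕ → Series
  K j = sumInf (K-term j)

  K-summable : ∀ j → Summable (K-term j)
  K-summable j n = frac-summand _ _ (ℕP.m≤n+m n (j ℕ.* n ℕ.+ n ℕ.* n))

  K-common : ℕ → ℕ → Series
  K-common j n = Q n *S Z j n *S 1-x^ (suc j ℕ.+ n)

  K-common-shifted : ∀ j n → K-common j n ≗ (Q n *S Z (suc j) n) *S 1-x^ (suc j)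
  K-common-shifted j n = begin
    K-common j n                              ≈⟨ *S-assoc (Q n) (Z j n) (1-x^ (suc j ℕ.+ n)) ⟩
    Q n *S (Z j n *S 1-x^ (suc j ℕ.+ n))      ≈⟨ *S-congʳ (Q n) (λ m → trans (sym (Z-suc j n m)) (Z-front j n m)) ⟩
    Q n *S (1-x^ (suc j) *S Z (suc j) n)
      ≈⟨ solve 3 (λ Q W Z → Q :* (W :* Z) := (Q :* Z) :* W) (λ _ → refl) (Q n) (1-x^ (suc j)) (Z (suc j) n) ⟩
    (Q n *S Z (suc j) n) *S 1-x^ (suc j)      ∎
    where open ≗-Reasoning

  -- Termwise:  (1 - x^{j+1}) K-term j n + x^{j+1} K-term (j+1) n = F-term (j+1) n;
  -- after multiplying by K-common this is  W ((1 - v) X + X v) = W X.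
  K-relation-term : ∀ j n → 1-x^ (suc j) *S K-term j n +S x^ (suc j) *S K-term (suc j) n ≗ F-term (suc j) n
  K-relation-term j n = cancelˡ M _ _ (cong (_* 1ℤ) (QZ-constant j n)) cleared
    where
    open ≗-Reasoning
    M = K-common j n
    W = 1-x^ (suc j)
    V = 1-x^ (suc j ℕ.+ n)
    w = x^ (suc j)
    v = x^ (suc j ℕ.+ n)
    e = j ℕ.* n ℕ.+ n ℕ.* n ℕ.+ n
    e′ = suc j ℕ.* n ℕ.+ n ℕ.* n ℕ.+ n
    exponent₁ : ∀ j n → suc j ℕ.+ (suc j ℕ.* n ℕ.+ n ℕ.* n ℕ.+ n)
                        ≡ (j ℕ.* n ℕ.+ n ℕ.* n ℕ.+ n) ℕ.+ (suc j ℕ.+ n)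
    exponent₁ = ℕSolver.solve-∀
    exponent₂ : ∀ j n → suc j ℕ.* n ℕ.+ n ℕ.* n ≡ j ℕ.* n ℕ.+ n ℕ.* n ℕ.+ n
    exponent₂ = ℕSolver.solve-∀
    shift : w *S x^ e′ ≗ x^ e *S v
    shift m = trans (x^-+ (suc j) e′ m) (trans (x^-cong (exponent₁ j n) m) (sym (x^-+ e (suc j ℕ.+ n) m)))
    MK : M *S K-term j n ≗ V *S x^ e
    MK = clear-denominator M (Q n *S Z j n) V (x^ e) (QZ-constant j n) (λ _ → refl)
    MK′ : M *S K-term (suc j) n ≗ W *S x^ e′
    MK′ = clear-denominator M (Q n *S Z (suc j) n) W (x^ e′) (QZ-constant (suc j) n) (K-common-shifted j n)
    MF : M *S F-term (suc j) n ≗ W *S x^ e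
    MF m = trans (clear-denominator M (Q n *S Z (suc j) n) W (x^ (suc j ℕ.* n ℕ.+ n ℕ.* n))
                                    (QZ-constant (suc j) n) (K-common-shifted j n) m)
                 (*S-congʳ W (x^-cong (exponent₂ j n)) m)
    cleared : M *S (W *S K-term j n +S w *S K-term (suc j) n) ≗ M *S F-term (suc j) n
    cleared = begin
      M *S (W *S K-term j n +S w *S K-term (suc j) n)
        ≈⟨ solve 5 (λ M W w A B → M :* (W :* A :+ w :* B) := W :* (M :* A) :+ w :* (M :* B))
                 (λ _ → refl) M W w (K-term j n) (K-term (suc j) n) ⟩
      W *S (M *S K-term j n) +S w *S (M *S K-term (suc j) n)
        ≈⟨ +S-cong (*S-congʳ W MK) (*S-congʳ w MK′) ⟩
      W *S (V *S x^ e) +S w *S (W *S x^ e′)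
        ≈⟨ solve 5 (λ W V X w X′ → W :* (V :* X) :+ w :* (W :* X′) := W :* (V :* X) :+ W :* (w :* X′))
                 (λ _ → refl) W V (x^ e) w (x^ e′) ⟩
      W *S (V *S x^ e) +S W *S (w *S x^ e′)
        ≈⟨ +S-cong (*S-congʳ W (*S-congˡ (x^ e) (1-x^-expand (suc j ℕ.+ n)))) (*S-congʳ W shift) ⟩
      W *S ((constS 1ℤ +S -S v) *S x^ e) +S W *S (x^ e *S v)
        ≈⟨ solve 3 (λ W X v → W :* ((con 1ℤ :- v) :* X) :+ W :* (X :* v) := W :* X) (λ _ → refl) W (x^ e) v ⟩
      W *S x^ e                       ≈⟨ MF ⟨
      M *S F-term (suc j) n           ∎

  K-relation : ∀ j → 1-x^ (suc j) *S K j +S x^ (suc j) *S K (suc j) ≗ F (suc j)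
  K-relation j = begin
    1-x^ (suc j) *S K j +S x^ (suc j) *S K (suc j)
      ≈⟨ +S-cong (sumInf-*ˡ (1-x^ (suc j)) (K-term j) (K-summable j))
                 (sumInf-*ˡ (x^ (suc j)) (K-term (suc j)) (K-summable (suc j))) ⟩
    sumInf (λ n → 1-x^ (suc j) *S K-term j n) +S sumInf (λ n → x^ (suc j) *S K-term (suc j) n)
      ≈⟨ sumInf-+ (λ n → 1-x^ (suc j) *S K-term j n) (λ n → x^ (suc j) *S K-term (suc j) n) ⟨
    sumInf (λ n → 1-x^ (suc j) *S K-term j n +S x^ (suc j) *S K-term (suc j) n)
      ≈⟨ sumInf-cong _ _ (K-relation-term j) ⟩
    F (suc j) ∎
    where open ≗-Reasoning

  H : ℕ → Series
  H j = P∞ j *S K j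

  H-step : ∀ j → H j ≗ constS 1ℤ +S -S (x^ (suc j) *S H (suc j))
  H-step j = begin
    P∞ j *S K j                         ≈⟨ *S-congˡ (K j) (P∞-peel j) ⟩
    (W *S P) *S K j
      ≈⟨ solve 5 (λ W P K w K′ → (W :* P) :* K := P :* (W :* K :+ w :* K′) :- w :* (P :* K′))
               (λ _ → refl) W P (K j) w (K (suc j)) ⟩
    P *S (W *S K j +S w *S K (suc j)) +S -S (w *S H (suc j))
      ≈⟨ +S-cong (*S-congʳ P (K-relation j)) (λ _ → refl) ⟩
    P *S F (suc j) +S -S (w *S H (suc j))
      ≈⟨ +S-cong (λ m → trans (P∞-F (suc j) m) (sym (constS-one m))) (λ _ → refl) ⟩
    constS 1ℤ +S -S (w *S H (suc j))    ∎
    where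
    open ≗-Reasoning
    W = 1-x^ (suc j)
    w = x^ (suc j)
    P = P∞ (suc j)

  R-term : ℕ → ℕ → Series
  R-term j n = mono (s ℕ.* (j ℕ.* n ℕ.+ tri n)) (sign n)

  R : ℕ → Series
  R j = sumInf (R-term j)

  n≤tri : ∀ n → n ℕ.≤ tri n
  n≤tri zero    = z≤n
  n≤tri (suc n) = ℕP.m≤m+n (suc n) (tri n)

  R-summable : ∀ j → Summable (R-term j)
  R-summable j n = Ord-weaken (ℕP.≤-trans (ℕP.≤-trans (n≤tri n) (ℕP.m≤n+m (tri n) (j ℕ.* n))) (ℕP.m≤n*m _ s))
                              (Ord-mono (s ℕ.* (j ℕ.* n ℕ.+ tri n)) (sign n))

  R-term-zero : ∀ j → R-term j 0 ≗ constS 1ℤ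
  R-term-zero j m = trans (mono-cong (vanish s j) refl m) (trans (mono-zero-one m) (sym (constS-one m)))
    where
    vanish : ∀ s j → s ℕ.* (j ℕ.* 0 ℕ.+ 0) ≡ 0
    vanish = ℕSolver.solve-∀

  R-term-suc : ∀ j n → R-term j (suc n) ≗ -S (x^ (suc j) *S R-term (suc j) n)
  R-term-suc j n m = begin
    R-term j (suc n) m
      ≡⟨ mono-cong (exponent s j n (tri n)) (sym (ℤP.*-identityˡ (- sign n))) m ⟩
    mono (s ℕ.* suc j ℕ.+ s ℕ.* (suc j ℕ.* n ℕ.+ tri n)) (1ℤ * - sign n) m
      ≡⟨ mono-mono (s ℕ.* suc j) _ 1ℤ (- sign n) m ⟨
    (x^ (suc j) *S mono (s ℕ.* (suc j ℕ.* n ℕ.+ tri n)) (- sign n)) m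
      ≡⟨ *S-congʳ (x^ (suc j)) (mono-neg _ (sign n)) m ⟩
    (x^ (suc j) *S -S R-term (suc j) n) m
      ≡⟨ solve 2 (λ w r → w :* (:- r) := :- (w :* r)) (λ _ → refl) (x^ (suc j)) (R-term (suc j) n) m ⟩
    (-S (x^ (suc j) *S R-term (suc j) n)) m ∎
    where
    open ≡-Reasoning
    exponent : ∀ s j n t → s ℕ.* (j ℕ.* suc n ℕ.+ (suc n ℕ.+ t))
                           ≡ s ℕ.* suc j ℕ.+ s ℕ.* (suc j ℕ.* n ℕ.+ t)
    exponent = ℕSolver.solve-∀

  R-step : ∀ j → R j ≗ constS 1ℤ +S -S (x^ (suc j) *S R (suc j))
  R-step j = begin
    R j                                              ≈⟨ sumInf-front (R-term j) (R-summable j) ⟩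
    R-term j 0 +S sumInf (R-term j ∘ suc)            ≈⟨ +S-cong (R-term-zero j) (sumInf-cong _ _ (R-term-suc j)) ⟩
    constS 1ℤ +S sumInf (λ n → -S (x^ (suc j) *S R-term (suc j) n))
      ≈⟨ +S-cong {constS 1ℤ} (λ _ → refl) (sumInf-neg (λ n → x^ (suc j) *S R-term (suc j) n)) ⟩
    constS 1ℤ +S -S sumInf (λ n → x^ (suc j) *S R-term (suc j) n)
      ≈⟨ +S-cong {constS 1ℤ} (λ _ → refl) (-S-cong (sumInf-*ˡ (x^ (suc j)) (R-term (suc j)) (R-summable (suc j)))) ⟨
    constS 1ℤ +S -S (x^ (suc j) *S R (suc j))       ∎
    where open ≗-Reasoning

  -- The common recursion has a unique solution, since x^{j+1} is divisible by q.
  H≗R : ∀ j → H j ≗ R j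
  H≗R j m = difference-zero (contraction-zero D (λ j → -S x^ (suc j)) factor-Ord D-step j m)
    where
    D : ℕ → Series
    D j = H j +S -S R j
    factor-Ord : ∀ j → Ord 1 (-S x^ (suc j))
    factor-Ord j = Ord-neg {f = x^ (suc j)} (Ord-weaken (s≤s z≤n) (x^-Ord (suc j)))
    D-step : ∀ j → D j ≗ (-S x^ (suc j)) *S D (suc j)
    D-step j = begin
      H j +S -S R j                 ≈⟨ +S-cong (H-step j) (-S-cong (R-step j)) ⟩
      (constS 1ℤ +S -S (w *S H (suc j))) +S -S (constS 1ℤ +S -S (w *S R (suc j)))
        ≈⟨ solve 3 (λ w H R → (con 1ℤ :- w :* H) :- (con 1ℤ :- w :* R) := (:- w) :* (H :- R))
                 (λ _ → refl) w (H (suc j)) (R (suc j)) ⟩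
      (-S w) *S D (suc j)           ∎
      where
      open ≗-Reasoning
      w = x^ (suc j)

  -- Since (1 - x) B-term n = x K-term 1 n, the left side is x (x²; x)_∞ K 1 = x H 1 = x R 1.
  B-term : ℕ → Series
  B-term n = frac (suc n ℕ.* suc n) (Q n *S Q (suc n))

  A-term : ℕ → Series
  A-term n = mono (s ℕ.* tri (suc n)) (sign n)

  B-summable : Summable B-term
  B-summable n = frac-summand _ _ (ℕP.≤-trans (ℕP.n≤1+n n) (n≤n*n (suc n)))

  B-common : ℕ → Series
  B-common n = Q n *S Z 1 n *S 1-x^ 1

  B-common-as-B : ∀ n → B-common n ≗ (Q n *S Q (suc n)) *S constS 1ℤ
  B-common-as-B n = begin
    B-common n
      ≈⟨ solve 3 (λ Q Z W → Q :* Z :* W := (Q :* (W :* Z)) :* con 1ℤ) (λ _ → refl) (Q n) (Z 1 n) (1-x^ 1) ⟩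
    (Q n *S (1-x^ 1 *S Z 1 n)) *S constS 1ℤ  ≈⟨ *S-congˡ (constS 1ℤ) (*S-congʳ (Q n) (Q-front n)) ⟨
    (Q n *S Q (suc n)) *S constS 1ℤ          ∎
    where open ≗-Reasoning

  -- (1 - x) B-term n = x K-term 1 n; after clearing denominators both sides are (1 - x) x^{(n+1)²}.
  B-relation : ∀ n → 1-x^ 1 *S B-term n ≗ x^ 1 *S K-term 1 n
  B-relation n = cancelˡ M _ _ (cong (_* 1ℤ) (QZ-constant 1 n)) cleared
    where
    open ≗-Reasoning
    M = B-common n
    W = 1-x^ 1
    e = 1 ℕ.* n ℕ.+ n ℕ.* n ℕ.+ n
    X = x^ (suc n ℕ.* suc n)
    exponent : ∀ n → 1 ℕ.+ (1 ℕ.* n ℕ.+ n ℕ.* n ℕ.+ n) ≡ suc n ℕ.* suc n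
    exponent = ℕSolver.solve-∀
    split : X ≗ x^ 1 *S x^ e
    split m = sym (trans (x^-+ 1 e m) (x^-cong (exponent n) m))
    MB : M *S B-term n ≗ constS 1ℤ *S X
    MB = clear-denominator M (Q n *S Q (suc n)) (constS 1ℤ) X
           (*S-constant-one {Q n} {Q (suc n)} (poch-constant t s n) (poch-constant t s (suc n))) (B-common-as-B n)
    MK : M *S K-term 1 n ≗ W *S x^ e
    MK = clear-denominator M (Q n *S Z 1 n) W (x^ e) (QZ-constant 1 n) (λ _ → refl)
    cleared : M *S (W *S B-term n) ≗ M *S (x^ 1 *S K-term 1 n)
    cleared = begin
      M *S (W *S B-term n)
        ≈⟨ solve 3 (λ M W B → M :* (W :* B) := W :* (M :* B)) (λ _ → refl) M W (B-term n) ⟩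
      W *S (M *S B-term n)                       ≈⟨ *S-congʳ W MB ⟩
      W *S (constS 1ℤ *S X)                      ≈⟨ *S-congʳ W (*S-congˡ X constS-one) ⟩
      W *S (oneS *S X)                           ≈⟨ *S-congʳ W (λ m → trans (*S-identityˡ X m) (split m)) ⟩
      W *S (x^ 1 *S x^ e)
        ≈⟨ solve 3 (λ W a b → W :* (a :* b) := a :* (W :* b)) (λ _ → refl) W (x^ 1) (x^ e) ⟩
      x^ 1 *S (W *S x^ e)                        ≈⟨ *S-congʳ (x^ 1) MK ⟨
      x^ 1 *S (M *S K-term 1 n)
        ≈⟨ solve 3 (λ M a K → a :* (M :* K) := M :* (a :* K)) (λ _ → refl) M (x^ 1) (K-term 1 n) ⟩
      M *S (x^ 1 *S K-term 1 n)                  ∎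

  core : pochInf s s *S sumInf B-term ≗ sumInf A-term
  core = begin
    pochInf s s *S sumInf B-term
      ≈⟨ *S-congˡ (sumInf B-term) (λ m → cong (λ a → pochInf a s m) (sym (ℕP.*-identityʳ s))) ⟩
    P∞ 0 *S sumInf B-term                      ≈⟨ *S-congˡ (sumInf B-term) (P∞-peel 0) ⟩
    (1-x^ 1 *S P∞ 1) *S sumInf B-term
      ≈⟨ solve 3 (λ W P B → (W :* P) :* B := P :* (W :* B)) (λ _ → refl) (1-x^ 1) (P∞ 1) (sumInf B-term) ⟩
    P∞ 1 *S (1-x^ 1 *S sumInf B-term)          ≈⟨ *S-congʳ (P∞ 1) (sumInf-*ˡ (1-x^ 1) B-term B-summable) ⟩
    P∞ 1 *S sumInf (λ n → 1-x^ 1 *S B-term n)   ≈⟨ *S-congʳ (P∞ 1) (sumInf-cong _ _ B-relation) ⟩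
    P∞ 1 *S sumInf (λ n → x^ 1 *S K-term 1 n)   ≈⟨ *S-congʳ (P∞ 1) (sumInf-*ˡ (x^ 1) (K-term 1) (K-summable 1)) ⟨
    P∞ 1 *S (x^ 1 *S K 1)
      ≈⟨ solve 3 (λ P a K → P :* (a :* K) := a :* (P :* K)) (λ _ → refl) (P∞ 1) (x^ 1) (K 1) ⟩
    x^ 1 *S H 1                                ≈⟨ *S-congʳ (x^ 1) (H≗R 1) ⟩
    x^ 1 *S R 1                                ≈⟨ sumInf-*ˡ (x^ 1) (R-term 1) (R-summable 1) ⟩
    sumInf (λ n → x^ 1 *S R-term 1 n)          ≈⟨ sumInf-cong _ _ x-R-term ⟩
    sumInf A-term                              ∎
    where
    open ≗-Reasoning
    exponent : ∀ s n t → s ℕ.* 1 ℕ.+ s ℕ.* (1 ℕ.* n ℕ.+ t) ≡ s ℕ.* (suc n ℕ.+ t)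
    exponent = ℕSolver.solve-∀
    x-R-term : ∀ n → x^ 1 *S R-term 1 n ≗ A-term n
    x-R-term n m = trans (mono-mono (s ℕ.* 1) _ 1ℤ (sign n) m)
                         (mono-cong (exponent s n (tri n)) (ℤP.*-identityˡ (sign n)) m)

-- Grouping the factors 1 - q^k by k mod 3:
--   (q; q)_{3N} = (q; q³)_N (q²; q³)_N (q³; q³)_N.
poch-by-residue : ∀ N → poch 1 1 (3 ℕ.* N) ≗ poch 1 3 N *S poch 2 3 N *S poch 3 3 N
poch-by-residue zero m = sym (trans (*S-identityʳ (oneS *S oneS) m) (*S-identityˡ oneS m))
poch-by-residue (suc N) = begin
  poch 1 1 (3 ℕ.* suc N)                       ≈⟨ (λ m → cong (λ k → poch 1 1 k m) (exponent₀ N)) ⟩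
  poch 1 1 (3 ℕ.* N) *S oneMinus (1 ℕ.+ 1 ℕ.* (3 ℕ.* N))
                     *S oneMinus (1 ℕ.+ 1 ℕ.* suc (3 ℕ.* N)) *S oneMinus (1 ℕ.+ 1 ℕ.* suc (suc (3 ℕ.* N)))
    ≈⟨ *S-cong (*S-cong (*S-cong (poch-by-residue N) (oneMinus-cong (exponent₁ N)))
                        (oneMinus-cong (exponent₂ N))) (oneMinus-cong (exponent₃ N)) ⟩
  a *S b *S c *S o₁ *S o₂ *S o₃
    ≈⟨ solve 6 (λ a b c o₁ o₂ o₃ → a :* b :* c :* o₁ :* o₂ :* o₃ := (a :* o₁) :* (b :* o₂) :* (c :* o₃))
             (λ _ → refl) a b c o₁ o₂ o₃ ⟩
  (a *S o₁) *S (b *S o₂) *S (c *S o₃)          ∎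
  where
  open ≗-Reasoning
  a = poch 1 3 N
  b = poch 2 3 N
  c = poch 3 3 N
  o₁ = oneMinus (1 ℕ.+ 3 ℕ.* N)
  o₂ = oneMinus (2 ℕ.+ 3 ℕ.* N)
  o₃ = oneMinus (3 ℕ.+ 3 ℕ.* N)
  exponent₀ : ∀ N → 3 ℕ.* suc N ≡ suc (suc (suc (3 ℕ.* N)))
  exponent₀ = ℕSolver.solve-∀
  exponent₁ : ∀ N → 1 ℕ.+ 1 ℕ.* (3 ℕ.* N) ≡ 1 ℕ.+ 3 ℕ.* N
  exponent₁ = ℕSolver.solve-∀
  exponent₂ : ∀ N → 1 ℕ.+ 1 ℕ.* suc (3 ℕ.* N) ≡ 2 ℕ.+ 3 ℕ.* N
  exponent₂ = ℕSolver.solve-∀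
  exponent₃ : ∀ N → 1 ℕ.+ 1 ℕ.* suc (suc (3 ℕ.* N)) ≡ 3 ℕ.+ 3 ℕ.* N
  exponent₃ = ℕSolver.solve-∀

pochInf-by-residue : pochInf 1 1 ≗ (pochInf 1 3 *S pochInf 2 3) *S pochInf 3 3
pochInf-by-residue m =
  trans (pochInf-stable 0 0 m≤3[m+1])
        (trans (poch-by-residue (suc m) m)
               (*S-cong≤ _ _ _ _ m
                 (λ k k≤m → *S-cong≤ _ _ _ _ k
                    (λ i i≤k → sym (pochInf-stable 0 2 (≤-m+1 (ℕP.≤-trans i≤k k≤m))))
                    (λ i i≤k → sym (pochInf-stable 1 2 (≤-m+1 (ℕP.≤-trans i≤k k≤m)))))
                 (λ k k≤m → sym (pochInf-stable 2 2 (≤-m+1 k≤m)))))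
  where
  ≤-m+1 : ∀ {i} → i ℕ.≤ m → i ℕ.≤ suc m
  ≤-m+1 = ℕP.m≤n⇒m≤1+n
  m≤3[m+1] : m ℕ.≤ 3 ℕ.* suc m
  m≤3[m+1] = ℕP.≤-trans (ℕP.n≤1+n m) (ℕP.m≤n*m (suc m) 3)

-- Theorem 4.1.  Write X = (q, q²; q³)_∞ and P = (q³; q³)_∞.  By the core
-- identity in x = q³, P · RHS-sum = LHS-sum, and (q; q)_∞ = X P; hence
--   (q; q)_∞⁻¹ · LHS-sum = X⁻¹ P⁻¹ · LHS-sum = X⁻¹ · RHS-sum.
theorem4p1 : (m : ℕ) → lhs4p1 m ≡ rhs4p1 m
theorem4p1 = begin
  inv (pochInf 1 1) *S sumInf A-term
    ≈⟨ *S-congˡ (sumInf A-term) (inv-cong _ _ refl (*S-constant-one {X} {P} X-constant refl) pochInf-by-residue) ⟩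
  inv (X *S P) *S sumInf A-term        ≈⟨ *S-congˡ (sumInf A-term) (inv-* X P X-constant refl) ⟩
  (inv X *S inv P) *S sumInf A-term    ≈⟨ *S-assoc (inv X) (inv P) (sumInf A-term) ⟩
  inv X *S (inv P *S sumInf A-term)    ≈⟨ *S-congʳ (inv X) (inv-unique P (sumInf B-term) (sumInf A-term) refl core) ⟨
  inv X *S sumInf B-term               ∎
  where
  open ≗-Reasoning
  open InVariable 2 using (core; A-term; B-term)
  X = pochInf 1 3 *S pochInf 2 3
  P = pochInf 3 3
  X-constant : X 0 ≡ 1ℤ
  X-constant = *S-constant-one {pochInf 1 3} {pochInf 2 3} refl refl
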